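{- Let $T$ be a tree rooted at a non-leaf vertex $r$, with leaves $l_1,\ldots,l_m$ numbered in the order in which they appear in some depth-first traversal of $T$ starting from $r$, and let $k\geq 1$. For $0\leq i\leq k-1$ let $I_i$ be the interval graph on $V(T)$ in which distinct $u,v$ are adjacent iff $f_i(u)\cap f_i(v)\neq\emptyset$, where $f_i(u)=[s(p^i(u)),\,t(p^{k-1-i}(u))]$, and let $I'$ be the interval graph on $V(T)$ in which distinct $u,v$ are adjacent iff $f'(u)\cap f'(v)\neq\emptyset$, where $f'(u)=[d_T(r,u),\,d_T(r,u)+k]$. If $u,v$ are distinct vertices with $(u,v)\notin E(T^k)$, then either $(u,v)\notin E(I')$ or there exists $i\in\{0,\ldots,k-1\}$ with $(u,v)\notin E(I_i)$.
   Context: $d_T(u,v)$ is the distance in $T$; $T^k$ is the graph on $V(T)$ in which distinct $u,v$ are adjacent iff $d_T(u,v)\leq k$. For vertices $u,v$, $u\preceq v$ means $u$ lies on the unique path from $r$ to $v$ in $T$. For $u\neq r$, $p(u)$ is the neighbour of $u$ on the path from $u$ to $r$, and $p(r)=r$; $p^0(u)=u$ and $p^j(u)=p(p^{j-1}(u))$ for $j\geq 1$. For a vertex $u$, $L(u)=\{i : u\preceq l_i\}$, $s(u)=\min L(u)$ and $t(u)=\max L(u)$. -}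

module Defs where

open import Data.Nat using (ℕ; zero; suc; _≤_; _<_; _∸_; _+_)
open import Data.Fin using (Fin; toℕ)
open import Data.Product using (Σ; _×_)
open import Data.Sum using (_⊎_)
open import Relation.Nullary using (¬_)
open import Relation.Binary.PropositionalEquality using (_≡_; _≢_)
open import Function.Definitions using (Injective; Surjective)

-- A rooted tree T on vertex set Fin n is given by its root r and parent map p
-- (p r ≡ r, and every vertex reaches r by iterating p; see lemma9 hypotheses).
-- The edges of T are the pairs {u , p u} with u ≢ r.

iter : ∀ {n} → (Fin n → Fin n) → ℕ → Fin n → Fin n
iter p zero    u = u
iter p (suc j) u = p (iter p j u)

Adj : ∀ {n} → (Fin n → Fin n) → Fin n → Fin n → Set
Adj p x y = x ≢ y × (p x ≡ y ⊎ p y ≡ x)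

data Walk {n} (p : Fin n → Fin n) : Fin n → Fin n → ℕ → Set where
  nil  : ∀ {x} → Walk p x x zero
  cons : ∀ {x y z d} → Adj p x y → Walk p y z d → Walk p x z (suc d)

IsDist : ∀ {n} → (Fin n → Fin n) → Fin n → Fin n → ℕ → Set
IsDist p u v d = Walk p u v d × (∀ d' → Walk p u v d' → d ≤ d')

-- u ⪯ v : u lies on the path from r to v, i.e. u = p^j(v) for some j
_⊑[_]_ : ∀ {n} → Fin n → (Fin n → Fin n) → Fin n → Set
u ⊑[ p ] v = Σ ℕ λ j → iter p j v ≡ u

Leaf : ∀ {n} → (Fin n → Fin n) → Fin n → Set
Leaf p u = Σ _ λ w → Adj p u w × (∀ w' → Adj p u w' → w' ≡ w)

-- seq : positions → vertices is a depth-first traversal of T from r: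
-- it lists every vertex exactly once, starts at r, and every next vertex is
-- a child of a vertex on the current root path (the DFS stack) of the
-- previously visited vertex.
IsDFS : ∀ {n} → (Fin n → Fin n) → Fin n → (Fin n → Fin n) → Set
IsDFS p r seq =
  Injective _≡_ _≡_ seq × Surjective _≡_ _≡_ seq ×
  (∀ a → toℕ a ≡ 0 → seq a ≡ r) ×
  (∀ a b → toℕ b ≡ suc (toℕ a) → p (seq b) ⊑[ p ] seq a)

-- l : Fin m → vertices enumerates exactly the leaves of T (l_1,...,l_m,
-- here indexed 0,...,m-1) in the order in which they appear in seq
LeafNumbering : ∀ {n m} → (Fin n → Fin n) → (Fin n → Fin n) → (Fin m → Fin n) → Set
LeafNumbering {n} {m} p seq l =
  (∀ i → Leaf p (l i)) ×
  (∀ u → Leaf p u → Σ (Fin m) λ i → l i ≡ u) ×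
  (∀ i j a b → seq a ≡ l i → seq b ≡ l j → toℕ i < toℕ j → toℕ a < toℕ b)

-- s(u) = min L(u), where L(u) = { i : u ⪯ l_i }
IsMinL : ∀ {n m} → (Fin n → Fin n) → (Fin m → Fin n) → Fin n → ℕ → Set
IsMinL {m = m} p l u x =
  (Σ (Fin m) λ i → toℕ i ≡ x × u ⊑[ p ] l i) ×
  (∀ (i : Fin m) → u ⊑[ p ] l i → x ≤ toℕ i)

-- t(u) = max L(u)
IsMaxL : ∀ {n m} → (Fin n → Fin n) → (Fin m → Fin n) → Fin n → ℕ → Set
IsMaxL {m = m} p l u x =
  (Σ (Fin m) λ i → toℕ i ≡ x × u ⊑[ p ] l i) ×
  (∀ (i : Fin m) → u ⊑[ p ] l i → toℕ i ≤ x)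

Meets : ℕ → ℕ → ℕ → ℕ → Set
Meets a b c d = Σ ℕ λ x → (a ≤ x × x ≤ b) × (c ≤ x × x ≤ d)

EdgeTk : ∀ {n} → (Fin n → Fin n) → ℕ → Fin n → Fin n → Set
EdgeTk p k u v = u ≢ v × Σ ℕ λ d → IsDist p u v d × d ≤ k

EdgeI : ∀ {n} → (Fin n → Fin n) → (s t : Fin n → ℕ) → ℕ → ℕ → Fin n → Fin n → Set
EdgeI p s t k i u v =
  u ≢ v × Meets (s (iter p i u)) (t (iter p (k ∸ 1 ∸ i) u))
                (s (iter p i v)) (t (iter p (k ∸ 1 ∸ i) v))

EdgeI' : ∀ {n} → (D : Fin n → ℕ) → ℕ → Fin n → Fin n → Set
EdgeI' D k u v = u ≢ v × Meets (D u) (D u + k) (D v) (D v + k)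

module Submission where

-- Follow u and v
-- upwards to their last common ancestor w = p^α(u) = p^β(v); then α + β > k.
--   * If α = 0 or β = 0, one vertex is an ancestor of the other, their depths
--     differ by more than k, and the intervals f'(u), f'(v) are disjoint.
--   * Otherwise the children c₁ = p^(α-1)(u) and c₂ = p^(β-1)(v) of w are
--     incomparable, so in the depth-first order one subtree, say that of c₁,
--     is visited entirely before the other; hence t(X) < s(Y) for X below c₁
--     and Y below c₂.  Splitting the budget k-1 ≤ (α-1) + (β-1) as
--     (k-1-i) + i with k-1-i ≤ α-1 and i ≤ β-1 puts p^(k-1-i)(u) below c₁ and
--     p^i(v) below c₂, so f_i(u) ends before f_i(v) starts.

open import Defs
open import Data.Nat using (ℕ; zero; suc; _≤_; _<_; _+_; _∸_; z≤n; s≤s; _≤?_)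
open import Data.Nat.Properties
open import Data.Fin using (Fin; toℕ; fromℕ<)
open import Data.Fin.Properties using (toℕ-injective; toℕ<n; toℕ-fromℕ<; any?) renaming (_≟_ to _≟F_)
open import Data.Product using (Σ; _×_; _,_; proj₁; proj₂)
open import Data.Sum using (_⊎_; inj₁; inj₂)
open import Data.Empty using (⊥-elim)
open import Function using (_∘_)
open import Relation.Nullary using (¬_; Dec; yes; no)
open import Relation.Nullary.Decidable using (_×-dec_; map′)
open import Relation.Binary using (tri<; tri≈; tri>)
open import Relation.Binary.PropositionalEquality

module LeastNumber (P : ℕ → Set) (P? : ∀ d → Dec (P d)) where

  private
    search : ∀ m → (∀ d → d < m → ¬ P d) ⊎ (Σ ℕ λ d → d < m × P d × (∀ d' → d' < d → ¬ P d'))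
    search zero = inj₁ (λ d ())
    search (suc m) with search m
    ... | inj₂ (d , d<m , Pd , below) = inj₂ (d , m<n⇒m<1+n d<m , Pd , below)
    ... | inj₁ none with P? m
    ...   | yes Pm = inj₂ (m , n<1+n m , Pm , none)
    ...   | no ¬Pm = inj₁ none≤m
      where
      none≤m : ∀ d → d < suc m → ¬ P d
      none≤m d (s≤s d≤m) with m≤n⇒m<n∨m≡n d≤m
      ... | inj₁ d<m = none d d<m
      ... | inj₂ refl = ¬Pm

  least : ∀ m → P m → Σ ℕ λ d → P d × d ≤ m × (∀ d' → P d' → d ≤ d')
  least m Pm with search (suc m)
  ... | inj₁ none = ⊥-elim (none m (n<1+n m) Pm)
  ... | inj₂ (d , d<1+m , Pd , below) = d , Pd , ≤-pred d<1+m , λ d' Pd' → ≮⇒≥ (λ d'<d → below d' d'<d Pd')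

meets-apart : ∀ {a b c d} → b < c → ¬ Meets a b c d
meets-apart b<c (x , (_ , x≤b) , (c≤x , _)) = <⇒≱ b<c (≤-trans c≤x x≤b)

meets-sym : ∀ {a b c d} → Meets a b c d → Meets c d a b
meets-sym (x , in₁ , in₂) = x , in₂ , in₁

EdgeI'-sym : ∀ {n} (D : Fin n → ℕ) k {u v} → EdgeI' D k u v → EdgeI' D k v u
EdgeI'-sym D k (u≢v , meet) = u≢v ∘ sym , meets-sym meet

+-below-∸ : ∀ {a b k} → k < b ∸ a → a + k < b
+-below-∸ {a} {b} {k} k<b∸a =
  subst (_≤ b) (cong suc (+-comm k a)) (m≤o∸n⇒m+n≤o (suc k) a≤b k<b∸a)
  where
  a≤b : a ≤ b
  a≤b = <⇒≤ (m∸n≢0⇒n<m (λ b∸a≡0 → n≮0 (subst (k <_) b∸a≡0 k<b∸a)))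

split-budget : ∀ K a b → K ≤ a + b → Σ ℕ λ i → i ≤ K × i ≤ b × K ∸ i ≤ a
split-budget K a b K≤a+b with b ≤? K
... | yes b≤K = b , b≤K , ≤-refl , ≤-trans (∸-monoˡ-≤ b K≤a+b) (≤-reflexive (m+n∸n≡m a b))
... | no b≰K = K , ≤-refl , <⇒≤ (≰⇒> b≰K) , subst (_≤ a) (sym (n∸n≡0 K)) z≤n

fork-budget : ∀ {k} a b → 1 ≤ k → k < suc a + suc b → k ∸ 1 ≤ a + b
fork-budget {k} a b 1≤k k<len =
  m+n≤o⇒m≤o∸n (k ∸ 1) {1} (≤-trans (≤-reflexive (m∸n+n≡m 1≤k)) (≤-pred (subst (k <_) (+-suc (suc a) b) k<len)))

<-of-≤-pred : ∀ {i k} → 1 ≤ k → i ≤ k ∸ 1 → i < k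
<-of-≤-pred {i} {k} 1≤k i≤K = subst (_≤ k) (+-comm i 1) (m≤o∸n⇒m+n≤o i 1≤k i≤K)

fin-witness : ∀ {k} (P : ℕ → Set) {i} → i < k → P i → Σ (Fin k) λ j → P (toℕ j)
fin-witness P i<k Pi = fromℕ< i<k , subst P (sym (toℕ-fromℕ< i<k)) Pi

module RootedTree {n : ℕ} (p : Fin n → Fin n) (r : Fin n) (p-root : p r ≡ r)
                  (reach : ∀ u → Σ ℕ λ j → iter p j u ≡ r) where

  _⊑_ : Fin n → Fin n → Set
  x ⊑ y = x ⊑[ p ] y

  iter-suc : ∀ j u → iter p j (p u) ≡ p (iter p j u)
  iter-suc zero u = refl
  iter-suc (suc j) u = cong p (iter-suc j u)

  iter-+ : ∀ i j u → iter p (i + j) u ≡ iter p i (iter p j u)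
  iter-+ zero j u = refl
  iter-+ (suc i) j u = cong p (iter-+ i j u)

  iter-root : ∀ j → iter p j r ≡ r
  iter-root zero = refl
  iter-root (suc j) = trans (cong p (iter-root j)) p-root

  ⊑-refl : ∀ {x} → x ⊑ x
  ⊑-refl = 0 , refl

  ⊑-trans : ∀ {x y z} → x ⊑ y → y ⊑ z → x ⊑ z
  ⊑-trans {z = z} (i , y↑i≡x) (j , z↑j≡y) =
    i + j , trans (iter-+ i j z) (trans (cong (iter p i) z↑j≡y) y↑i≡x)

  ⊑-iter : ∀ {e j} x → e ≤ j → iter p j x ⊑ iter p e x
  ⊑-iter {e} {j} x e≤j = j ∸ e , trans (sym (iter-+ (j ∸ e) e x)) (cong (λ q → iter p q x) (m∸n+n≡m e≤j))

  private
    least-root-power : ∀ u → Σ ℕ λ d → iter p d u ≡ r × d ≤ proj₁ (reach u) × (∀ d' → iter p d' u ≡ r → d ≤ d')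
    least-root-power u = LeastNumber.least (λ j → iter p j u ≡ r) (λ j → iter p j u ≟F r) (proj₁ (reach u)) (proj₂ (reach u))

  depth : Fin n → ℕ
  depth u = proj₁ (least-root-power u)

  depth-reaches : ∀ u → iter p (depth u) u ≡ r
  depth-reaches u = proj₁ (proj₂ (least-root-power u))

  depth-least : ∀ u j → iter p j u ≡ r → depth u ≤ j
  depth-least u = proj₂ (proj₂ (proj₂ (least-root-power u)))

  depth-root : depth r ≡ 0
  depth-root = n≤0⇒n≡0 (depth-least r 0 refl)

  depth-parent : ∀ x → x ≢ r → depth x ≡ suc (depth (p x))
  depth-parent x x≢r = ≤-antisym upper lower
    where
    upper : depth x ≤ suc (depth (p x))
    upper = depth-least x (suc (depth (p x))) (trans (sym (iter-suc (depth (p x)) x)) (depth-reaches (p x)))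
    lower : suc (depth (p x)) ≤ depth x
    lower with depth x | depth-reaches x
    ... | zero | x≡r = ⊥-elim (x≢r x≡r)
    ... | suc e | reaches = s≤s (depth-least (p x) e (trans (iter-suc e x) reaches))

  depth-parent-≤ : ∀ x → depth (p x) ≤ depth x
  depth-parent-≤ x with x ≟F r
  ... | yes refl = ≤-reflexive (cong depth p-root)
  ... | no x≢r = subst (depth (p x) ≤_) (sym (depth-parent x x≢r)) (n≤1+n _)

  depth-adj : ∀ {x y} → Adj p x y → depth y ≤ suc (depth x)
  depth-adj {x} (_ , inj₁ refl) = m≤n⇒m≤1+n (depth-parent-≤ x)
  depth-adj {x} {y} (_ , inj₂ py≡x) with y ≟F r
  ... | yes refl = subst (_≤ suc (depth x)) (sym depth-root) z≤n
  ... | no y≢r = ≤-reflexive (trans (depth-parent y y≢r) (cong (suc ∘ depth) py≡x))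

  depth-walk : ∀ {x y d} → Walk p x y d → depth y ≤ depth x + d
  depth-walk {x} nil = m≤m+n (depth x) 0
  depth-walk {x} (cons {y = z} {d = d} x~z w) =
    ≤-trans (depth-walk w) (subst (depth z + d ≤_) (sym (+-suc (depth x) d)) (+-monoˡ-≤ d (depth-adj x~z)))

  depth-iter : ∀ j z {y} → iter p j z ≡ y → y ≢ r → depth z ≡ depth y + j
  depth-iter zero z refl _ = sym (+-identityʳ _)
  depth-iter (suc j) z {y} z↑≡y y≢r =
    trans (depth-parent z z≢r) (trans (cong suc (depth-iter j (p z) (trans (iter-suc j z) z↑≡y) y≢r)) (sym (+-suc (depth y) j)))
    where
    z≢r : z ≢ r
    z≢r refl = y≢r (trans (sym z↑≡y) (iter-root (suc j)))

  ⊑-canonical : ∀ {x y} → y ⊑ x → iter p (depth x ∸ depth y) x ≡ y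
  ⊑-canonical {x} {y} (j , x↑j≡y) with y ≟F r
  ... | yes refl = subst (λ d → iter p (depth x ∸ d) x ≡ r) (sym depth-root) (depth-reaches x)
  ... | no y≢r = subst (λ d → iter p d x ≡ y) (sym steps) x↑j≡y
    where
    steps : depth x ∸ depth y ≡ j
    steps = trans (cong (_∸ depth y) (depth-iter j x x↑j≡y y≢r)) (m+n∸m≡n (depth y) j)

  _⊑?_ : ∀ x y → Dec (x ⊑ y)
  x ⊑? y = map′ (λ e → depth y ∸ depth x , e) ⊑-canonical (iter p (depth y ∸ depth x) y ≟F x)

  siblings-incomparable : ∀ {x y} → x ≢ y → x ≢ r → y ≢ r → p x ≡ p y → ¬ x ⊑ y
  siblings-incomparable x≢y _ _ _ (zero , y≡x) = x≢y (sym y≡x)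
  siblings-incomparable {x} {y} _ x≢r y≢r px≡py (suc j , y↑≡x) =
    m+1+n≰m (depth x) (≤-reflexive (trans (sym (depth-iter (suc j) y y↑≡x x≢r)) same-depth))
    where
    same-depth : depth y ≡ depth x
    same-depth = trans (depth-parent y y≢r) (trans (cong (suc ∘ depth) (sym px≡py)) (sym (depth-parent x x≢r)))

  adj-sym : ∀ {x y} → Adj p x y → Adj p y x
  adj-sym (x≢y , inj₁ e) = x≢y ∘ sym , inj₂ e
  adj-sym (x≢y , inj₂ e) = x≢y ∘ sym , inj₁ e

  private
    snoc : ∀ {x y z d} → Walk p x y d → Adj p y z → Walk p x z (suc d)
    snoc nil y~z = cons y~z nil
    snoc (cons x~w w) y~z = cons x~w (snoc w y~z)

  rev : ∀ {x y d} → Walk p x y d → Walk p y x d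
  rev nil = nil
  rev (cons x~y w) = snoc (rev w) (adj-sym x~y)

  _++ʷ_ : ∀ {x y z a b} → Walk p x y a → Walk p y z b → Walk p x z (a + b)
  nil ++ʷ w = w
  cons x~y w₁ ++ʷ w₂ = cons x~y (w₁ ++ʷ w₂)

  -- Climbing j steps is a walk of length at most j (steps at the root are free).
  walk-up : ∀ j u → Σ ℕ λ d → d ≤ j × Walk p u (iter p j u) d
  walk-up zero u = 0 , z≤n , nil
  walk-up (suc j) u with walk-up j (p u) | u ≟F p u
  ... | d , d≤j , w | yes u≡pu = d , m≤n⇒m≤1+n d≤j , subst₂ (λ a b → Walk p a b d) (sym u≡pu) (iter-suc j u) w
  ... | d , d≤j , w | no u≢pu = suc d , s≤s d≤j , subst (λ b → Walk p u b (suc d)) (iter-suc j u) (cons (u≢pu , inj₁ refl) w)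

  adj? : ∀ x y → Dec (Adj p x y)
  adj? x y with x ≟F y | p x ≟F y | p y ≟F x
  ... | yes x≡y | _ | _ = no (λ x~y → proj₁ x~y x≡y)
  ... | no x≢y | yes px≡y | _ = yes (x≢y , inj₁ px≡y)
  ... | no x≢y | no _ | yes py≡x = yes (x≢y , inj₂ py≡x)
  ... | no _ | no px≢y | no py≢x = no λ { (_ , inj₁ e) → px≢y e ; (_ , inj₂ e) → py≢x e }

  walk? : ∀ d x y → Dec (Walk p x y d)
  walk? zero x y with x ≟F y
  ... | yes refl = yes nil
  ... | no x≢y = no λ { nil → x≢y refl }
  walk? (suc d) x y with any? (λ z → adj? x z ×-dec walk? d z y)
  ... | yes (z , x~z , w) = yes (cons x~z w)
  ... | no none = no λ { (cons {y = z} x~z w) → none (z , x~z , w) }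

  shortest-walk : ∀ {x y d} → Walk p x y d → Σ ℕ λ d₀ → IsDist p x y d₀ × d₀ ≤ d
  shortest-walk {x} {y} {d} w with LeastNumber.least (λ e → Walk p x y e) (λ e → walk? e x y) d w
  ... | d₀ , w₀ , d₀≤d , shortest = d₀ , (w₀ , shortest) , d₀≤d

  long-walks : ∀ k {u v} → u ≢ v → ¬ EdgeTk p k u v → ∀ {d} → Walk p u v d → k < d
  long-walks k u≢v not-close w with shortest-walk w
  ... | d₀ , dist , d₀≤d = ≰⇒> (λ d≤k → not-close (u≢v , d₀ , dist , ≤-trans d₀≤d d≤k))

  distance-from-root : ∀ {u d} → IsDist p r u d → d ≡ depth u
  distance-from-root {u} {d} (w , shortest) with walk-up (depth u) u
  ... | e , e≤depth , up =
    ≤-antisym (≤-trans (shortest e (rev (subst (λ z → Walk p u z e) (depth-reaches u) up))) e≤depth)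
              (subst (λ q → depth u ≤ q + d) depth-root (depth-walk w))

  ancestor-gap : ∀ k {x y} → y ⊑ x → (∀ {d} → Walk p x y d → k < d) → depth y + k < depth x
  ancestor-gap k {x} {y} y⊑x long with walk-up (depth x ∸ depth y) x
  ... | d , d≤gap , up = +-below-∸ (<-≤-trans (long (subst (λ z → Walk p x z d) (⊑-canonical y⊑x) up)) d≤gap)

  no-I'-edge : (D : Fin n → ℕ) → (∀ w → IsDist p r w (D w)) → ∀ k {u v} → depth u + k < depth v → ¬ EdgeI' D k u v
  no-I'-edge D dist k {u} {v} gap (_ , meet) =
    meets-apart (subst₂ (λ a b → a + k < b) (sym (distance-from-root (dist u))) (sym (distance-from-root (dist v))) gap) meet

  data Meeting (u v : Fin n) : Set where
    ancestor   : u ⊑ v → Meeting u v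
    descendant : v ⊑ u → Meeting u v
    fork       : ∀ a b → p (iter p a u) ≡ p (iter p b v)
               → ¬ iter p a u ⊑ iter p b v → ¬ iter p b v ⊑ iter p a u → Meeting u v

  -- The fork is found by climbing from u to the least ancestor above v, then
  -- climbing from v to it in the least number of steps.
  meeting : ∀ u v → Meeting u v
  meeting u v
    with LeastNumber.least (λ j → iter p j u ⊑ v) (λ j → iter p j u ⊑? v)
           (depth u) (depth v , trans (depth-reaches v) (sym (depth-reaches u)))
  ... | zero , u⊑v , _ , _ = ancestor u⊑v
  ... | suc a , (β , v↑β≡w) , _ , α-least
    with LeastNumber.least (λ j → iter p j v ≡ iter p (suc a) u) (λ j → iter p j v ≟F iter p (suc a) u) β v↑β≡w
  ... | zero , v≡w , _ , _ = descendant (suc a , sym v≡w)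
  ... | suc b , v↑≡w , _ , β-least =
    fork a b (sym v↑≡w) (siblings-incomparable c₁≢c₂ c₁≢r c₂≢r (sym v↑≡w))
                        (siblings-incomparable (c₁≢c₂ ∘ sym) c₂≢r c₁≢r v↑≡w)
    where
    c₁⋢v : ¬ iter p a u ⊑ v
    c₁⋢v c₁⊑v = n≮n a (α-least a c₁⊑v)
    c₁≢r : iter p a u ≢ r
    c₁≢r c₁≡r = c₁⋢v (β , trans v↑β≡w (trans (cong p c₁≡r) (trans p-root (sym c₁≡r))))
    c₂≢r : iter p b v ≢ r
    c₂≢r c₂≡r = n≮n b (β-least b (trans c₂≡r (trans (sym p-root) (trans (cong p (sym c₂≡r)) v↑≡w))))
    c₁≢c₂ : iter p a u ≢ iter p b v
    c₁≢c₂ c₁≡c₂ = c₁⋢v (b , sym c₁≡c₂)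

  fork-walk : ∀ {u v} a b → p (iter p a u) ≡ p (iter p b v) → Σ ℕ λ d → d ≤ suc a + suc b × Walk p u v d
  fork-walk {u} {v} a b fork-point with walk-up (suc a) u | walk-up (suc b) v
  ... | d₁ , d₁≤ , up₁ | d₂ , d₂≤ , up₂ =
    d₁ + d₂ , +-mono-≤ d₁≤ d₂≤ , up₁ ++ʷ rev (subst (λ z → Walk p v z d₂) (sym fork-point) up₂)

  module DepthFirst (seq : Fin n → Fin n) (dfs : IsDFS p r seq) where

    seq-injective : ∀ {a b} → seq a ≡ seq b → a ≡ b
    seq-injective = proj₁ dfs

    pos : Fin n → Fin n
    pos y = proj₁ (proj₁ (proj₂ dfs) y)

    seq-pos : ∀ y → seq (pos y) ≡ y
    seq-pos y = proj₂ (proj₁ (proj₂ dfs) y) refl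

    pos-of : ∀ {a y} → seq a ≡ y → pos y ≡ a
    pos-of {a} refl = seq-injective (seq-pos (seq a))

    private
      starts-at-root : ∀ a → toℕ a ≡ 0 → seq a ≡ r
      starts-at-root = proj₁ (proj₂ (proj₂ dfs))

      next-on-stack : ∀ a b → toℕ b ≡ suc (toℕ a) → p (seq b) ⊑ seq a
      next-on-stack = proj₂ (proj₂ (proj₂ dfs))

      previous : ∀ {m} (a : Fin n) → toℕ a ≡ suc m → Σ (Fin n) λ b → toℕ b ≡ m
      previous {m} a a≡1+m = fromℕ< m<n , toℕ-fromℕ< m<n
        where m<n = <-trans (n<1+n m) (subst (_< n) a≡1+m (toℕ<n a))

      ancestor-first-at : ∀ m (a : Fin n) {y} → toℕ a ≡ m → y ⊑ seq a → toℕ (pos y) ≤ m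
      ancestor-first-at m a a≡m (zero , e) = ≤-reflexive (trans (cong toℕ (pos-of e)) a≡m)
      ancestor-first-at zero a a≡0 (suc j , e) = ≤-reflexive (trans (cong toℕ (pos-of a≡y)) a≡0)
        where
        a≡r = starts-at-root a a≡0
        a≡y = trans a≡r (trans (sym (iter-root (suc j))) (trans (cong (iter p (suc j)) (sym a≡r)) e))
      ancestor-first-at (suc m) a a≡1+m (suc j , e) with previous a a≡1+m
      ... | b , b≡m = m≤n⇒m≤1+n (ancestor-first-at m b b≡m
                        (⊑-trans (j , trans (iter-suc j (seq a)) e) (next-on-stack b a (trans a≡1+m (cong suc (sym b≡m))))))

    ancestor-first : ∀ {x y} → y ⊑ x → toℕ (pos y) ≤ toℕ (pos x)
    ancestor-first {x} {y} y⊑x = ancestor-first-at _ (pos x) refl (subst (y ⊑_) (sym (seq-pos x)) y⊑x)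

    private
      step-back : ∀ {x} (a c c' : Fin n) → toℕ a < toℕ c → toℕ c ≡ suc (toℕ c') → x ⊑ seq a → x ⊑ seq c → x ⊑ seq c'
      step-back a c c' a<c _ x⊑a (zero , e) =
        ⊥-elim (<⇒≱ a<c (subst (λ q → toℕ q ≤ toℕ a) (pos-of e) (ancestor-first-at _ a refl x⊑a)))
      step-back a c c' _ c≡1+c' _ (suc j , e) = ⊑-trans (j , trans (iter-suc j (seq c)) e) (next-on-stack c' c c≡1+c')

      interval-gap : ∀ g {x} (a b c : Fin n) → toℕ a < toℕ b → toℕ c ≡ toℕ b + g → x ⊑ seq a → x ⊑ seq c → x ⊑ seq b
      interval-gap zero {x} a b c _ c≡b _ x⊑c = subst (λ q → x ⊑ seq q) (toℕ-injective (trans c≡b (+-identityʳ _))) x⊑c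
      interval-gap (suc g) a b c a<b c≡b+1+g x⊑a x⊑c with previous c (trans c≡b+1+g (+-suc _ g))
      ... | c' , c'≡b+g = interval-gap g a b c' a<b c'≡b+g x⊑a
            (step-back a c c' (<-≤-trans a<b (subst (toℕ b ≤_) (sym c≡b+1+g) (m≤m+n _ _)))
                       (trans c≡b+1+g (trans (+-suc _ g) (cong suc (sym c'≡b+g)))) x⊑a x⊑c)

    subtree-interval : ∀ {x y z w} → x ⊑ y → x ⊑ z → toℕ (pos y) < toℕ (pos w) → toℕ (pos w) ≤ toℕ (pos z) → x ⊑ w
    subtree-interval {x} {y} {z} {w} x⊑y x⊑z y<w w≤z =
      subst (x ⊑_) (seq-pos w)
        (interval-gap (toℕ (pos z) ∸ toℕ (pos w)) (pos y) (pos w) (pos z) y<w (sym (m+[n∸m]≡n w≤z)) (at x⊑y) (at x⊑z))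
      where
      at : ∀ {v} → x ⊑ v → x ⊑ seq (pos v)
      at {v} = subst (x ⊑_) (sym (seq-pos v))

    subtree-before : ∀ {c₁ c₂ X Y} → ¬ c₁ ⊑ c₂ → toℕ (pos c₁) < toℕ (pos c₂) → c₁ ⊑ X → c₂ ⊑ Y → toℕ (pos X) < toℕ (pos Y)
    subtree-before c₁⋢c₂ c₁<c₂ c₁⊑X c₂⊑Y =
      ≰⇒> (λ Y≤X → c₁⋢c₂ (subtree-interval ⊑-refl c₁⊑X c₁<c₂ (≤-trans (ancestor-first c₂⊑Y) Y≤X)))

    module Leaves (m : ℕ) (l : Fin m → Fin n) (numbering : LeafNumbering p seq l)
                  (s t : Fin n → ℕ) (s-min : ∀ u → IsMinL p l u (s u)) (t-max : ∀ u → IsMaxL p l u (t u)) where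

      leaf-order : ∀ i j → toℕ (pos (l i)) < toℕ (pos (l j)) → toℕ i < toℕ j
      leaf-order i j lt with <-cmp (toℕ i) (toℕ j)
      ... | tri< i<j _ _ = i<j
      ... | tri≈ _ i≡j _ = ⊥-elim (<-irrefl (cong (λ q → toℕ (pos (l q))) (toℕ-injective i≡j)) lt)
      ... | tri> _ _ j<i = ⊥-elim (<-asym lt (proj₂ (proj₂ numbering) j i _ _ (seq-pos (l j)) (seq-pos (l i)) j<i))

      Before : Fin n → Fin n → Set
      Before c₁ c₂ = ∀ {X Y} → c₁ ⊑ X → c₂ ⊑ Y → t X < s Y

      leaves-before : ∀ {c₁ c₂} → ¬ c₁ ⊑ c₂ → toℕ (pos c₁) < toℕ (pos c₂) → Before c₁ c₂
      leaves-before c₁⋢c₂ c₁<c₂ {X} {Y} c₁⊑X c₂⊑Y with proj₁ (t-max X) | proj₁ (s-min Y)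
      ... | i , i≡tX , X⊑lᵢ | j , j≡sY , Y⊑lⱼ =
        subst₂ _<_ i≡tX j≡sY (leaf-order i j (subtree-before c₁⋢c₂ c₁<c₂ (⊑-trans c₁⊑X X⊑lᵢ) (⊑-trans c₂⊑Y Y⊑lⱼ)))

      subtrees-ordered : ∀ {c₁ c₂} → ¬ c₁ ⊑ c₂ → ¬ c₂ ⊑ c₁ → Before c₁ c₂ ⊎ Before c₂ c₁
      subtrees-ordered {c₁} {c₂} c₁⋢c₂ c₂⋢c₁ with <-cmp (toℕ (pos c₁)) (toℕ (pos c₂))
      ... | tri< c₁<c₂ _ _ = inj₁ (leaves-before c₁⋢c₂ c₁<c₂)
      ... | tri≈ _ same _ = ⊥-elim (c₁⋢c₂ (0 , trans (sym (seq-pos c₂)) (trans (cong seq (sym (toℕ-injective same))) (seq-pos c₁))))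
      ... | tri> _ _ c₂<c₁ = inj₂ (leaves-before c₂⋢c₁ c₂<c₁)

      fork-separates : ∀ {u v} a b k → 1 ≤ k → k < suc a + suc b
                     → ¬ iter p a u ⊑ iter p b v → ¬ iter p b v ⊑ iter p a u
                     → Σ (Fin k) λ i → ¬ EdgeI p s t k (toℕ i) u v
      fork-separates {u} {v} a b k 1≤k k<len c₁⋢c₂ c₂⋢c₁ with subtrees-ordered c₁⋢c₂ c₂⋢c₁
      ... | inj₁ c₁-first with split-budget (k ∸ 1) a b (fork-budget a b 1≤k k<len)
      ...   | i , i≤K , i≤b , K∸i≤a =
        fin-witness (λ j → ¬ EdgeI p s t k j u v) (<-of-≤-pred 1≤k i≤K)
          (λ (_ , meet) → meets-apart (c₁-first (⊑-iter u K∸i≤a) (⊑-iter v i≤b)) meet)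
      fork-separates {u} {v} a b k 1≤k k<len c₁⋢c₂ c₂⋢c₁ | inj₂ c₂-first
        with split-budget (k ∸ 1) b a (subst (k ∸ 1 ≤_) (+-comm a b) (fork-budget a b 1≤k k<len))
      ...   | i , i≤K , i≤a , K∸i≤b =
        fin-witness (λ j → ¬ EdgeI p s t k j u v) (<-of-≤-pred 1≤k i≤K)
          (λ (_ , meet) → meets-apart (c₂-first (⊑-iter v K∸i≤b) (⊑-iter u i≤a)) (meets-sym meet))


lemma9 : ∀ {n} (p : Fin n → Fin n) (r : Fin n)
    → p r ≡ r
    → (∀ u → Σ ℕ λ j → iter p j u ≡ r)
    → ¬ Leaf p r
    → (seq : Fin n → Fin n) → IsDFS p r seq
    → (m : ℕ) (l : Fin m → Fin n) → LeafNumbering p seq l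
    → (s t : Fin n → ℕ) → (∀ u → IsMinL p l u (s u)) → (∀ u → IsMaxL p l u (t u))
    → (D : Fin n → ℕ) → (∀ u → IsDist p r u (D u))
    → (k : ℕ) → 1 ≤ k
    → (u v : Fin n) → u ≢ v → ¬ EdgeTk p k u v
    → ¬ EdgeI' D k u v ⊎ Σ (Fin k) λ i → ¬ EdgeI p s t k (toℕ i) u v
lemma9 p r p-root reach _ seq dfs m l numbering s t s-min t-max D dist k 1≤k u v u≢v not-close =
  separate (meeting u v)
  where
  open RootedTree p r p-root reach
  open DepthFirst seq dfs
  open Leaves m l numbering s t s-min t-max

  long : ∀ {d} → Walk p u v d → k < d
  long = long-walks k u≢v not-close

  separate : Meeting u v → ¬ EdgeI' D k u v ⊎ Σ (Fin k) λ i → ¬ EdgeI p s t k (toℕ i) u v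
  separate (ancestor u⊑v) = inj₁ (no-I'-edge D dist k (ancestor-gap k u⊑v (long ∘ rev)))
  separate (descendant v⊑u) = inj₁ (no-I'-edge D dist k (ancestor-gap k v⊑u long) ∘ EdgeI'-sym D k)
  separate (fork a b fork-point c₁⋢c₂ c₂⋢c₁) with fork-walk a b fork-point
  ... | d , d≤ , w = inj₂ (fork-separates a b k 1≤k (<-≤-trans (long w) d≤) c₁⋢c₂ c₂⋢c₁)
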